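{- Let $n\ge 3$ be an integer and let $\mathcal{G}(x,1)$ be the Grundy numbers of the subtraction game with subtraction set $\{2,4n,4n+2\}$ and a one-time pass, as defined in the context. Let $P=(3,2,2,3)$, $Q=(1,0,0,1)$, $R=(1,2,0,1)$, $S=(3,0,2,3)$. Then for every $t\in\mathbb{Z}_{\ge0}$, the sequence $(\mathcal{G}(x,1))_{x=12n+9+8nt,\dots,20n+8+8nt}$ equals the concatenation $P^{n-2}\,Q\,R\,Q^{n-2}\,P\,S$ (juxtaposition denotes concatenation, $X^j$ denotes $j$ consecutive copies of $X$). In particular, $\mathcal{G}(x+8n,1)=\mathcal{G}(x,1)$ for all $x\ge 12n+9$.
   Context: A position is $(x,p)$ with $x\in\mathbb{Z}_{\ge0}$ the number of stones in a single pile and $p\in\{0,1\}$, where $p=1$ means the (one-time, shared) pass is still available and $p=0$ means it is not. From $(x,p)$ one may remove $s\in\{2,4n,4n+2\}$ stones with $s\le x$, moving to $(x-s,p)$; additionally, from $(x,1)$ with $x\ge 1$ one may pass, moving to $(x,0)$. The player unable to move loses. With $\operatorname{mex}(S)$ the least nonnegative integer not in $S$, the Grundy numbers are: $\mathcal{G}(x,0)=\operatorname{mex}\{\mathcal{G}(x-s,0): s\in\{2,4n,4n+2\},\ s\le x\}$, and $\mathcal{G}(x,1)=\operatorname{mex}\big(\{\mathcal{G}(x-s,1): s\in\{2,4n,4n+2\},\ s\le x\}\cup\{\mathcal{G}(x,0)\}\big)$ for $x\ge1$, $\mathcal{G}(0,1)=0$. -}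

module Defs where

open import Data.Nat using (ℕ; zero; suc; _+_; _*_; _∸_; _≡ᵇ_; _≤ᵇ_)
open import Data.Bool using (Bool; true; false; if_then_else_; _∧_)
open import Data.List using (List; []; _∷_; length; map)
open import Data.Bool.ListAction using (any)
open import Data.Product using (_×_; _,_; proj₁; proj₂)

-- mex S : the least natural number not occurring in the list S.
-- Search k = 0,1,2,...; at most (length S) values can lie in S, so
-- fuel (length S) suffices: mexFrom returns the first k not in S.
mexFrom : List ℕ → ℕ → ℕ → ℕ
mexFrom S k zero = k
mexFrom S k (suc f) = if any (λ y → y ≡ᵇ k) S then mexFrom S (suc k) f else k

mex : List ℕ → ℕ
mex S = mexFrom S 0 (length S)

moves : ℕ → List ℕ
moves n = 2 ∷ 4 * n ∷ 4 * n + 2 ∷ []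

keepLegal : ℕ → List ℕ → List ℕ
keepLegal x [] = []
keepLegal x (s ∷ ss) = if (1 ≤ᵇ s) ∧ (s ≤ᵇ x) then s ∷ keepLegal x ss else keepLegal x ss

legal : ℕ → ℕ → List ℕ
legal n x = keepLegal x (moves n)

at : List (ℕ × ℕ) → ℕ → ℕ × ℕ
at [] _ = (0 , 0)
at (y ∷ ys) zero = y
at (y ∷ ys) (suc i) = at ys i

-- table n x = [ (G(x,0), G(x,1)) , (G(x-1,0), G(x-1,1)) , … , (G(0,0), G(0,1)) ]
-- (most recent first), for the game with subtraction set moves n.
-- Entry at index i is the pair for the pile size x - i.
table : ℕ → ℕ → List (ℕ × ℕ)
table n zero = (0 , 0) ∷ []
table n (suc x) = (g0 , g1) ∷ prev
  where
    prev = table n x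
    -- position (suc x) - s sits at index s ∸ 1 of prev
    opts = map (λ s → at prev (s ∸ 1)) (legal n (suc x))
    g0 = mex (map proj₁ opts)
    g1 = mex (g0 ∷ map proj₂ opts)

G0 : ℕ → ℕ → ℕ
G0 n x = proj₁ (at (table n x) 0)

G1 : ℕ → ℕ → ℕ
G1 n x = proj₂ (at (table n x) 0)

blockP blockQ blockR blockS : List ℕ
blockP = 3 ∷ 2 ∷ 2 ∷ 3 ∷ []
blockQ = 1 ∷ 0 ∷ 0 ∷ 1 ∷ []
blockR = 1 ∷ 2 ∷ 0 ∷ 1 ∷ []
blockS = 3 ∷ 0 ∷ 2 ∷ 3 ∷ []

{-# OPTIONS --safe #-}

-- Write a pile size as x = k·4n + j with j < 4n (row k, column j). The moves 2, 4n and 4n + 2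
-- lead from cell (k, j) to (k, j − 2), (k − 1, j) and (k − 1, j − 2), where (k, j − 2) with j < 2
-- means (k − 1, 4n − 2 + j). Row by row, the pairs (𝒢(x,0), 𝒢(x,1)) follow a profile depending
-- only on the column and on the kind of the row: rows 0 to 3, then alternately even and odd rows.
-- Every profile is 4-periodic from column 10 on, so for n ≥ 3 the columns 4n − 2 + j behave like
-- the columns 10 + j, and that the six profiles obey the Grundy recurrence is a finite computation.
-- The window of the theorem consists of row 3 + 2t from column 9 on, row 4 + 2t, and columns 0–8 of
-- row 5 + 2t. The rows 4, 6, … share one profile, and so do the rows 5, 7, …, which agree with row 3
-- from column 9 on; hence the window does not depend on t, and this also gives the period 8n.
module Submission where

open import Defs
open import Data.Bool using (true; false)
open import Data.List using (List; []; _∷_; map; upTo; applyUpTo; concat; replicate; _++_)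
open import Data.List.Properties using (map-upTo; map-∘; ∷-injective)
open import Data.List.Relation.Binary.Pointwise using (Pointwise; Pointwise-≡⇒≡) renaming ([] to []ᵖ; _∷_ to _∷ᵖ_)
open import Data.Nat using (ℕ; zero; suc; _+_; _*_; _∸_; _≤_; _<_; _≤ᵇ_; _<ᵇ_; z≤n; s≤s; z<s; s<s; NonZero; _≟_; _<?_; allUpTo?)
open import Data.Nat.DivMod using (_/_; _%_; m≡m%n+[m/n]*n; m%n<n)
open import Data.Nat.Induction using (<-rec)
open import Data.Nat.Properties
open import Data.Nat.Tactic.RingSolver using (solve; solve-∀)
open import Data.Product using (_×_; _,_; proj₁; proj₂)
open import Data.Product.Properties using (≡-dec)
open import Function using (_∘_)
open import Relation.Binary.Definitions using (DecidableEquality)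
open import Relation.Binary.PropositionalEquality using (_≡_; refl; sym; trans; cong; cong₂; subst; module ≡-Reasoning)
open import Relation.Nullary using (yes; no; contradiction)
open import Relation.Nullary.Decidable using (True; toWitness)
open import Relation.Nullary.Reflects using (ofʸ; ofⁿ)

open ≡-Reasoning

module _ {A : Set} where

  applyUpTo-++ : ∀ (f : ℕ → A) k l →
                 applyUpTo f (k + l) ≡ applyUpTo f k ++ applyUpTo (λ i → f (k + i)) l
  applyUpTo-++ f zero    l = refl
  applyUpTo-++ f (suc k) l = cong (f 0 ∷_) (applyUpTo-++ (f ∘ suc) k l)

  applyUpTo-cong : ∀ {f g : ℕ → A} k → (∀ {i} → i < k → f i ≡ g i) →
                   applyUpTo f k ≡ applyUpTo g k
  applyUpTo-cong zero    f≡g = refl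
  applyUpTo-cong (suc k) f≡g =
    cong₂ _∷_ (f≡g z<s) (applyUpTo-cong k (λ i<k → f≡g (s<s i<k)))

  applyUpTo-cong⁻¹ : ∀ {f g : ℕ → A} k → applyUpTo f k ≡ applyUpTo g k →
                     ∀ {i} → i < k → f i ≡ g i
  applyUpTo-cong⁻¹ (suc k) eq {zero}  _         = proj₁ (∷-injective eq)
  applyUpTo-cong⁻¹ (suc k) eq {suc i} (s<s i<k) = applyUpTo-cong⁻¹ k (proj₂ (∷-injective eq)) i<k

  periodic-shift : ∀ (f : ℕ → A) → (∀ i → f (4 + i) ≡ f i) → ∀ q i → f (4 * q + i) ≡ f i
  periodic-shift f f-per zero    i = refl
  periodic-shift f f-per (suc q) i = begin
    f (4 * suc q + i)   ≡⟨ cong (λ k → f (k + i)) (*-suc 4 q) ⟩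
    f (4 + (4 * q + i)) ≡⟨ f-per (4 * q + i) ⟩
    f (4 * q + i)       ≡⟨ periodic-shift f f-per q i ⟩
    f i                 ∎

  applyUpTo-periodic : ∀ (f : ℕ → A) → (∀ i → f (4 + i) ≡ f i) →
                       ∀ q → applyUpTo f (4 * q) ≡ concat (replicate q (applyUpTo f 4))
  applyUpTo-periodic f f-per zero    = refl
  applyUpTo-periodic f f-per (suc q) = begin
    applyUpTo f (4 * suc q)                      ≡⟨ cong (applyUpTo f) (*-suc 4 q) ⟩
    applyUpTo f 4 ++ applyUpTo (λ i → f (4 + i)) (4 * q)
      ≡⟨ cong (applyUpTo f 4 ++_) (applyUpTo-cong (4 * q) (λ {i} _ → f-per i)) ⟩
    applyUpTo f 4 ++ applyUpTo f (4 * q)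
      ≡⟨ cong (applyUpTo f 4 ++_) (applyUpTo-periodic f f-per q) ⟩
    concat (replicate (suc q) (applyUpTo f 4))   ∎

  rotate-blocks : ∀ (a b c d : A) q rest →
    a ∷ b ∷ c ∷ (concat (replicate q (d ∷ a ∷ b ∷ c ∷ [])) ++ d ∷ rest)
      ≡ concat (replicate (suc q) (a ∷ b ∷ c ∷ d ∷ [])) ++ rest
  rotate-blocks a b c d zero    rest = refl
  rotate-blocks a b c d (suc q) rest = cong (λ l → a ∷ b ∷ c ∷ d ∷ l) (rotate-blocks a b c d q rest)

module ColumnChecks {A : Set} (_≟_ : DecidableEquality A) (f g : ℕ → A) where

  agree-below : ∀ b → True (allUpTo? (λ j → f j ≟ g j) b) → ∀ j → j < b → f j ≡ g j
  agree-below b checked j j<b = toWitness checked j<b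

  agree-periodic : True (allUpTo? (λ j → f j ≟ g j) 14) →
                   (∀ j → f (14 + j) ≡ f (10 + j)) → (∀ j → g (14 + j) ≡ g (10 + j)) →
                   ∀ j → f j ≡ g j
  agree-periodic checked f-per g-per = <-rec _ agree
    where
    agree : ∀ j → (∀ {i} → i < j → f i ≡ g i) → f j ≡ g j
    agree j earlier with j <? 14
    ... | yes j<14 = agree-below 14 checked j j<14
    ... | no  j≮14 = begin
      f j          ≡⟨ cong f j≡ ⟨
      f (14 + d)   ≡⟨ f-per d ⟩
      f (10 + d)   ≡⟨ earlier (subst (10 + d <_) j≡ (+-monoˡ-< d (m<m+n 10 z<s))) ⟩
      g (10 + d)   ≡⟨ g-per d ⟨
      g (14 + d)   ≡⟨ cong g j≡ ⟩
      g j          ∎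
      where
      d = j ∸ 14
      j≡ : 14 + d ≡ j
      j≡ = m+[n∸m]≡n (≮⇒≥ j≮14)

open ColumnChecks (≡-dec _≟_ _≟_)

window-periodic : ∀ (f : ℕ → ℕ) a p .{{_ : NonZero p}} (L : List ℕ) →
                  (∀ t → map (λ i → f (a + p * t + i)) (upTo p) ≡ L) →
                  ∀ x → a ≤ x → f (x + p) ≡ f x
window-periodic f a p L window x a≤x = begin
  f (x + p)              ≡⟨ cong (λ y → f (y + p)) x≡ ⟩
  f (a + p * t + i + p)  ≡⟨ next-window t (m%n<n (x ∸ a) p) ⟩
  f (a + p * t + i)      ≡⟨ cong f x≡ ⟨
  f x                    ∎
  where
  shift : ∀ u v s r → u + v * s + r + v ≡ u + v * suc s + r
  shift = solve-∀
  rearrange : ∀ u r s v → u + (r + s * v) ≡ u + v * s + r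
  rearrange = solve-∀
  t i : ℕ
  t = (x ∸ a) / p
  i = (x ∸ a) % p
  entries : ∀ t → applyUpTo (λ i → f (a + p * t + i)) p ≡ L
  entries t = trans (sym (map-upTo _ p)) (window t)
  next-window : ∀ t {i} → i < p → f (a + p * t + i + p) ≡ f (a + p * t + i)
  next-window t {i} i<p = begin
    f (a + p * t + i + p)  ≡⟨ cong f (shift a p t i) ⟩
    f (a + p * suc t + i)  ≡⟨ applyUpTo-cong⁻¹ p (trans (entries (suc t)) (sym (entries t))) i<p ⟩
    f (a + p * t + i)      ∎
  decompose : ∀ d → a + d ≡ a + p * (d / p) + d % p
  decompose d = trans (cong (a +_) (m≡m%n+[m/n]*n d p)) (rearrange a (d % p) (d / p) p)
  x≡ : x ≡ a + p * t + i
  x≡ = trans (sym (m+[n∸m]≡n a≤x)) (decompose (x ∸ a))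

-- The pass from (x,1) to (x,0) adds 𝒢(x,0) to the options of (x,1).
grundy : List (ℕ × ℕ) → ℕ × ℕ
grundy options = g₀ , mex (g₀ ∷ map proj₂ options)
  where g₀ = mex (map proj₁ options)

m≡n+o⇒m∸n≡o : ∀ {m n o} → m ≡ n + o → m ∸ n ≡ o
m≡n+o⇒m∸n≡o {n = n} {o} refl = m+n∸m≡n n o

m≡n+o⇒n≤m : ∀ {m} n {o} → m ≡ n + o → n ≤ m
m≡n+o⇒n≤m n {o} refl = m≤m+n n o

-- Opaque, since letting the type checker unfold the table in conversions is prohibitively slow.
opaque
  G : ℕ → ℕ → ℕ × ℕ
  G n x = at (table n x) 0

  G-zero : ∀ n → G n 0 ≡ (0 , 0)
  G-zero n = refl

  G1≡proj₂-G : ∀ n x → G1 n x ≡ proj₂ (G n x)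
  G1≡proj₂-G n x = refl

  at-table : ∀ n {x i} → i ≤ x → at (table n x) i ≡ G n (x ∸ i)
  at-table n {x}     {zero}  _         = refl
  at-table n {suc x} {suc i} (s≤s i≤x) = at-table n i≤x

  options-in-table : ∀ n x ss →
    map (λ s → at (table n x) (s ∸ 1)) (keepLegal (suc x) ss)
      ≡ map (λ s → G n (suc x ∸ s)) (keepLegal (suc x) ss)
  options-in-table n x []           = refl
  options-in-table n x (zero  ∷ ss) = options-in-table n x ss
  options-in-table n x (suc s ∷ ss) with s <ᵇ suc x | <ᵇ-reflects-< s (suc x)
  ... | true  | ofʸ (s≤s s≤x) = cong₂ _∷_ (at-table n s≤x) (options-in-table n x ss)
  ... | false | _             = options-in-table n x ss

  G-recurrence : ∀ n {x ss ys} → 0 < x → legal n x ≡ ss → Pointwise (λ s y → x ≡ s + y) ss ys →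
                 G n x ≡ grundy (map (G n) ys)
  G-recurrence n {suc x} {ss} {ys} _ legal≡ positions = begin
    G n (suc x)                                             ≡⟨ cong grundy (options-in-table n x (moves n)) ⟩
    grundy (map (λ s → G n (suc x ∸ s)) (legal n (suc x)))  ≡⟨ cong grundy (map-∘ (legal n (suc x))) ⟩
    grundy (map (G n) (map (suc x ∸_) (legal n (suc x))))   ≡⟨ cong (grundy ∘ map (G n) ∘ map (suc x ∸_)) legal≡ ⟩
    grundy (map (G n) (map (suc x ∸_) ss))                  ≡⟨ cong (grundy ∘ map (G n)) (options positions) ⟩
    grundy (map (G n) ys)                                   ∎
    where
    options : ∀ {ss ys} → Pointwise (λ s y → suc x ≡ s + y) ss ys → map (suc x ∸_) ss ≡ ys
    options []ᵖ                  = refl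
    options (x≡s+y ∷ᵖ positions) = cong₂ _∷_ (m≡n+o⇒m∸n≡o x≡s+y) (options positions)

keepLegal-keep : ∀ {x} s ss → 1 ≤ s → s ≤ x → keepLegal x (s ∷ ss) ≡ s ∷ keepLegal x ss
keepLegal-keep {x} s ss 1≤s s≤x with 1 ≤ᵇ s | ≤ᵇ-reflects-≤ 1 s | s ≤ᵇ x | ≤ᵇ-reflects-≤ s x
... | true  | _        | true  | _        = refl
... | false | ofⁿ 1≰s | _     | _        = contradiction 1≤s 1≰s
... | true  | _        | false | ofⁿ s≰x = contradiction s≤x s≰x

keepLegal-drop : ∀ {x} s ss → x < s → keepLegal x (s ∷ ss) ≡ keepLegal x ss
keepLegal-drop {x} s ss x<s with 1 ≤ᵇ s | s ≤ᵇ x | ≤ᵇ-reflects-≤ s x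
... | false | _     | _        = refl
... | true  | false | _        = refl
... | true  | true  | ofʸ s≤x  = contradiction s≤x (<⇒≱ x<s)

legal-below : ∀ n {x} → 2 ≤ x → x < 4 * n → legal n x ≡ 2 ∷ []
legal-below n {x} 2≤x x<4n =
  trans (keepLegal-keep 2 (4 * n ∷ 4 * n + 2 ∷ []) (s≤s z≤n) 2≤x)
        (cong (2 ∷_) (trans (keepLegal-drop (4 * n) (4 * n + 2 ∷ []) x<4n)
                            (keepLegal-drop (4 * n + 2) [] (<-≤-trans x<4n (m≤m+n _ 2)))))

legal-between : ∀ n {x} → 1 ≤ n → 4 * n ≤ x → x < 4 * n + 2 → legal n x ≡ 2 ∷ 4 * n ∷ []
legal-between n {x} 1≤n 4n≤x x<4n+2 =
  trans (keepLegal-keep 2 (4 * n ∷ 4 * n + 2 ∷ []) (s≤s z≤n) (≤-trans (m≤n+m 2 2) (≤-trans 4≤4n 4n≤x)))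
        (cong (2 ∷_) (trans (keepLegal-keep (4 * n) (4 * n + 2 ∷ []) (≤-trans (s≤s z≤n) 4≤4n) 4n≤x)
                            (cong (4 * n ∷_) (keepLegal-drop (4 * n + 2) [] x<4n+2))))
  where 4≤4n = *-monoʳ-≤ 4 1≤n

legal-above : ∀ n {x} → 1 ≤ n → 4 * n + 2 ≤ x → legal n x ≡ moves n
legal-above n {x} 1≤n 4n+2≤x =
  trans (keepLegal-keep 2 (4 * n ∷ 4 * n + 2 ∷ []) (s≤s z≤n) (≤-trans (m≤n+m 2 (4 * n)) 4n+2≤x))
        (cong (2 ∷_) (trans (keepLegal-keep (4 * n) (4 * n + 2 ∷ []) 1≤4n (≤-trans (m≤m+n (4 * n) 2) 4n+2≤x))
                            (cong (4 * n ∷_) (keepLegal-keep (4 * n + 2) [] (≤-trans 1≤4n (m≤m+n _ 2)) 4n+2≤x))))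
  where 1≤4n = ≤-trans (s≤s z≤n) (*-monoʳ-≤ 4 1≤n)

data RowKind : Set where
  row0 row1 row2 row3 evenRow oddRow : RowKind

next : RowKind → RowKind
next row0    = row1
next row1    = row2
next row2    = row3
next row3    = evenRow
next evenRow = oddRow
next oddRow  = evenRow

kind : ℕ → RowKind
kind zero    = row0
kind (suc k) = next (kind k)

stripe : ℕ → ℕ
stripe 0 = 0
stripe 1 = 0
stripe 2 = 1
stripe 3 = 1
stripe (suc (suc (suc (suc j)))) = stripe j

level : RowKind → ℕ
level row0    = 0
level row1    = 2
level row2    = 0
level row3    = 2
level evenRow = 0
level oddRow  = 2

profile₀ : RowKind → ℕ → ℕ
profile₀ c j = level c + stripe j

-- Away from these exceptional cells 𝒢(x,1) = 𝒢(x,0) xor 1.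
profile₁ : RowKind → ℕ → ℕ
profile₁ row0    0 = 0
profile₁ row0    1 = 1
profile₁ row0    2 = 2
profile₁ row0    3 = 0
profile₁ row1    0 = 1
profile₁ row1    1 = 3
profile₁ row1    2 = 4
profile₁ row1    3 = 2
profile₁ row1    4 = 0
profile₁ row1    5 = 3
profile₁ row2    0 = 3
profile₁ row2    6 = 3
profile₁ row3    0 = 1
profile₁ row3    6 = 0
profile₁ row3    8 = 4
profile₁ evenRow 0 = 3
profile₁ evenRow 6 = 2
profile₁ oddRow  0 = 1
profile₁ oddRow  6 = 0
profile₁ c       j = level c + (1 ∸ stripe j)

profile : RowKind → ℕ → ℕ × ℕ
profile c j = profile₀ c j , profile₁ c j

profile-periodic : ∀ c j → profile c (14 + j) ≡ profile c (10 + j)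
profile-periodic row0    j = refl
profile-periodic row1    j = refl
profile-periodic row2    j = refl
profile-periodic row3    j = refl
profile-periodic evenRow j = refl
profile-periodic oddRow  j = refl

profile-shift : ∀ c q j → profile c (10 + 4 * q + j) ≡ profile c (10 + j)
profile-shift c = periodic-shift (λ j → profile c (10 + j)) (profile-periodic c)

row-zero-profile : ∀ j → profile row0 (2 + j) ≡ grundy (profile row0 j ∷ [])
row-zero-profile = agree-periodic _ _ _ (λ _ → refl) (λ _ → refl)

row-one-start-profile : ∀ j → j < 2 → profile row1 j ≡ grundy (profile row0 (10 + j) ∷ profile row0 j ∷ [])
row-one-start-profile = agree-below _ _ 2 _

row-start-profile : ∀ c j → j < 2 →
  profile (next (next c)) j ≡ grundy (profile (next c) (10 + j) ∷ profile (next c) j ∷ profile c (10 + j) ∷ [])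
row-start-profile row0    = agree-below _ _ 2 _
row-start-profile row1    = agree-below _ _ 2 _
row-start-profile row2    = agree-below _ _ 2 _
row-start-profile row3    = agree-below _ _ 2 _
row-start-profile evenRow = agree-below _ _ 2 _
row-start-profile oddRow  = agree-below _ _ 2 _

interior-profile : ∀ c j →
  profile (next c) (2 + j) ≡ grundy (profile (next c) j ∷ profile c (2 + j) ∷ profile c j ∷ [])
interior-profile row0    = agree-periodic _ _ _ (λ _ → refl) (λ _ → refl)
interior-profile row1    = agree-periodic _ _ _ (λ _ → refl) (λ _ → refl)
interior-profile row2    = agree-periodic _ _ _ (λ _ → refl) (λ _ → refl)
interior-profile row3    = agree-periodic _ _ _ (λ _ → refl) (λ _ → refl)
interior-profile evenRow = agree-periodic _ _ _ (λ _ → refl) (λ _ → refl)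
interior-profile oddRow  = agree-periodic _ _ _ (λ _ → refl) (λ _ → refl)

window-blocks : ∀ q →
  (3 ∷ 2 ∷ 2 ∷ concat (replicate q (3 ∷ 3 ∷ 2 ∷ 2 ∷ [])))
    ++ (3 ∷ 1 ∷ 0 ∷ 0 ∷ 1 ∷ 1 ∷ 2 ∷ 0 ∷ 1 ∷ 1 ∷ 0 ∷ 0 ∷ concat (replicate q (1 ∷ 1 ∷ 0 ∷ 0 ∷ [])))
    ++ (1 ∷ 3 ∷ 2 ∷ 2 ∷ 3 ∷ 3 ∷ 0 ∷ 2 ∷ 3 ∷ [])
  ≡ concat (replicate (suc q) blockP) ++ blockQ ++ blockR ++ concat (replicate (suc q) blockQ) ++ blockP ++ blockS
window-blocks q =
  trans (rotate-blocks 3 2 2 3 q _)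
        (cong (λ l → concat (replicate (suc q) blockP) ++ 1 ∷ 0 ∷ 0 ∷ 1 ∷ 1 ∷ 2 ∷ 0 ∷ 1 ∷ l) (rotate-blocks 1 0 0 1 q _))

kind-even : ∀ t → kind (4 + 2 * t) ≡ evenRow
kind-even zero    = refl
kind-even (suc t) = trans (cong (λ k → kind (4 + k)) (*-suc 2 t)) (cong (next ∘ next) (kind-even t))

profile₁-odd-rows : ∀ t j → profile₁ (kind (3 + 2 * t)) (9 + j) ≡ profile₁ oddRow (9 + j)
profile₁-odd-rows zero    j = refl
profile₁-odd-rows (suc t) j =
  cong (λ c → profile₁ c (9 + j)) (trans (cong (λ k → kind (3 + k)) (*-suc 2 t)) (cong next (kind-even t)))

-- n stays a variable, so that G1 n x never evaluates and the ring solver can treat n as a variable.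
module Rows (n m : ℕ) (n≡3+m : n ≡ 3 + m) where

  OnProfile : ℕ → ℕ → Set
  OnProfile k j = G n (k * (4 * n) + j) ≡ profile (kind k) j

  1≤n : 1 ≤ n
  1≤n = subst (1 ≤_) (sym n≡3+m) (s≤s z≤n)

  legal-one : legal n 1 ≡ []
  legal-one rewrite n≡3+m = refl

  row-zero : ∀ j → 2 + j < 4 * n → OnProfile 0 j → OnProfile 0 (2 + j)
  row-zero j 2+j<4n prev =
    trans (G-recurrence n z<s (legal-below n (s≤s (s≤s z≤n)) 2+j<4n) (refl ∷ᵖ []ᵖ))
          (trans (cong grundy (Pointwise-≡⇒≡ (prev ∷ᵖ []ᵖ))) (sym (row-zero-profile j)))

  row-one-start : ∀ j → j < 2 → OnProfile 0 (10 + 4 * m + j) → OnProfile 0 j → OnProfile 1 j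
  row-one-start j j<2 last first =
    trans (G-recurrence n (<-≤-trans z<s (m≡n+o⇒n≤m 2 x≡₁))
                          (legal-between n 1≤n (m≡n+o⇒n≤m (4 * n) x≡₂) x<4n+2)
                          (x≡₁ ∷ᵖ x≡₂ ∷ᵖ []ᵖ))
          (trans (cong grundy (Pointwise-≡⇒≡ (trans last (profile-shift row0 m j) ∷ᵖ first ∷ᵖ []ᵖ)))
                 (sym (row-one-start-profile j j<2)))
    where
    x≡₁ : 1 * (4 * n) + j ≡ 2 + (10 + 4 * m + j)
    x≡₁ rewrite n≡3+m = solve (m ∷ j ∷ [])
    x≡₂ : 1 * (4 * n) + j ≡ 4 * n + j
    x≡₂ = solve (n ∷ j ∷ [])
    x<4n+2 : 1 * (4 * n) + j < 4 * n + 2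
    x<4n+2 = subst (_< 4 * n + 2) (sym x≡₂) (+-monoʳ-< (4 * n) j<2)

  row-start : ∀ k j → j < 2 → OnProfile (suc k) (10 + 4 * m + j) → OnProfile (suc k) j →
              OnProfile k (10 + 4 * m + j) → OnProfile (2 + k) j
  row-start k j j<2 last first last′ =
    trans (G-recurrence n (<-≤-trans z<s (m≡n+o⇒n≤m 2 x≡₁))
                          (legal-above n 1≤n (m≡n+o⇒n≤m (4 * n + 2) x≡₃))
                          (x≡₁ ∷ᵖ x≡₂ ∷ᵖ x≡₃ ∷ᵖ []ᵖ))
          (trans (cong grundy (Pointwise-≡⇒≡ (trans last (profile-shift _ m j) ∷ᵖ first
                                                ∷ᵖ trans last′ (profile-shift _ m j) ∷ᵖ []ᵖ)))
                 (sym (row-start-profile (kind k) j j<2)))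
    where
    x≡₁ : (2 + k) * (4 * n) + j ≡ 2 + (suc k * (4 * n) + (10 + 4 * m + j))
    x≡₁ rewrite n≡3+m = solve (m ∷ k ∷ j ∷ [])
    x≡₂ : (2 + k) * (4 * n) + j ≡ 4 * n + (suc k * (4 * n) + j)
    x≡₂ = solve (n ∷ k ∷ j ∷ [])
    x≡₃ : (2 + k) * (4 * n) + j ≡ (4 * n + 2) + (k * (4 * n) + (10 + 4 * m + j))
    x≡₃ rewrite n≡3+m = solve (m ∷ k ∷ j ∷ [])

  interior : ∀ k j → OnProfile (suc k) j → OnProfile k (2 + j) → OnProfile k j → OnProfile (suc k) (2 + j)
  interior k j left below below-left =
    trans (G-recurrence n (<-≤-trans z<s (m≡n+o⇒n≤m 2 x≡₁))
                          (legal-above n 1≤n (m≡n+o⇒n≤m (4 * n + 2) x≡₃))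
                          (x≡₁ ∷ᵖ x≡₂ ∷ᵖ x≡₃ ∷ᵖ []ᵖ))
          (trans (cong grundy (Pointwise-≡⇒≡ (left ∷ᵖ below ∷ᵖ below-left ∷ᵖ []ᵖ)))
                 (sym (interior-profile (kind k) j)))
    where
    x≡₁ : suc k * (4 * n) + (2 + j) ≡ 2 + (suc k * (4 * n) + j)
    x≡₁ = solve (n ∷ k ∷ j ∷ [])
    x≡₂ : suc k * (4 * n) + (2 + j) ≡ 4 * n + (k * (4 * n) + (2 + j))
    x≡₂ = solve (n ∷ k ∷ j ∷ [])
    x≡₃ : suc k * (4 * n) + (2 + j) ≡ (4 * n + 2) + (k * (4 * n) + j)
    x≡₃ = solve (n ∷ k ∷ j ∷ [])

  last-column : ∀ {j} → j < 2 → 10 + 4 * m + j < 4 * n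
  last-column {j} j<2 = <-≤-trans (+-monoʳ-< (10 + 4 * m) j<2) (≤-reflexive row-length)
    where
    row-length : 10 + 4 * m + 2 ≡ 4 * n
    row-length rewrite n≡3+m = solve (m ∷ [])

  first-column : ∀ {j} → j < 2 → j < 4 * n
  first-column j<2 = <-≤-trans j<2 (≤-trans (s≤s (s≤s z≤n)) (*-monoʳ-≤ 4 1≤n))

  on-profile : ∀ k j → j < 4 * n → OnProfile k j
  on-profile 0 0 _ = G-zero n
  on-profile 0 1 _ = G-recurrence n z<s legal-one []ᵖ
  on-profile 0 (suc (suc j)) 2+j<4n = row-zero j 2+j<4n (on-profile 0 j (<-trans (m<n+m j z<s) 2+j<4n))
  on-profile 1 0 _ = row-one-start 0 z<s (on-profile 0 _ (last-column z<s)) (on-profile 0 0 (first-column z<s))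
  on-profile 1 1 _ =
    row-one-start 1 (s<s z<s) (on-profile 0 _ (last-column (s<s z<s))) (on-profile 0 1 (first-column (s<s z<s)))
  on-profile (suc (suc k)) 0 _ =
    row-start k 0 z<s (on-profile (suc k) _ (last-column z<s))
                      (on-profile (suc k) 0 (first-column z<s))
                      (on-profile k _ (last-column z<s))
  on-profile (suc (suc k)) 1 _ =
    row-start k 1 (s<s z<s) (on-profile (suc k) _ (last-column (s<s z<s)))
                            (on-profile (suc k) 1 (first-column (s<s z<s)))
                            (on-profile k _ (last-column (s<s z<s)))
  on-profile (suc k) (suc (suc j)) 2+j<4n =
    interior k j (on-profile (suc k) j j<4n) (on-profile k (2 + j) 2+j<4n) (on-profile k j j<4n)
    where j<4n = <-trans (m<n+m j z<s) 2+j<4n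

  row-values : ∀ k c len → c + len ≤ 4 * n →
               applyUpTo (λ i → G1 n (k * (4 * n) + (c + i))) len
                 ≡ applyUpTo (λ i → profile₁ (kind k) (c + i)) len
  row-values k c len fits = applyUpTo-cong len λ {i} i<len →
    trans (G1≡proj₂-G n (k * (4 * n) + (c + i)))
          (cong proj₂ (on-profile k (c + i) (<-≤-trans (+-monoʳ-< c i<len) fits)))

  4n≡ : 4 * n ≡ 12 + 4 * m
  4n≡ rewrite n≡3+m = solve (m ∷ [])

  odd-row-tail : ∀ t → applyUpTo (λ i → G1 n ((3 + 2 * t) * (4 * n) + (9 + i))) (3 + 4 * m)
                         ≡ 3 ∷ 2 ∷ 2 ∷ concat (replicate m (3 ∷ 3 ∷ 2 ∷ 2 ∷ []))
  odd-row-tail t = begin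
    applyUpTo (λ i → G1 n ((3 + 2 * t) * (4 * n) + (9 + i))) (3 + 4 * m)
      ≡⟨ row-values (3 + 2 * t) 9 (3 + 4 * m) (≤-reflexive (sym 4n≡)) ⟩
    applyUpTo (λ i → profile₁ (kind (3 + 2 * t)) (9 + i)) (3 + 4 * m)
      ≡⟨ applyUpTo-cong (3 + 4 * m) (λ {i} _ → profile₁-odd-rows t i) ⟩
    applyUpTo (λ i → profile₁ oddRow (9 + i)) (3 + 4 * m)
      ≡⟨ cong (λ l → 3 ∷ 2 ∷ 2 ∷ l) (applyUpTo-periodic (λ i → profile₁ oddRow (12 + i)) (λ _ → refl) m) ⟩
    3 ∷ 2 ∷ 2 ∷ concat (replicate m (3 ∷ 3 ∷ 2 ∷ 2 ∷ [])) ∎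

  even-row : ∀ t → applyUpTo (λ i → G1 n ((4 + 2 * t) * (4 * n) + i)) (4 * n)
                     ≡ 3 ∷ 1 ∷ 0 ∷ 0 ∷ 1 ∷ 1 ∷ 2 ∷ 0 ∷ 1 ∷ 1 ∷ 0 ∷ 0 ∷ concat (replicate m (1 ∷ 1 ∷ 0 ∷ 0 ∷ []))
  even-row t = begin
    applyUpTo (λ i → G1 n ((4 + 2 * t) * (4 * n) + i)) (4 * n)
      ≡⟨ row-values (4 + 2 * t) 0 (4 * n) ≤-refl ⟩
    applyUpTo (profile₁ (kind (4 + 2 * t))) (4 * n)
      ≡⟨ cong₂ (λ c l → applyUpTo (profile₁ c) l) (kind-even t) 4n≡ ⟩
    applyUpTo (profile₁ evenRow) (12 + 4 * m)
      ≡⟨ cong (λ l → 3 ∷ 1 ∷ 0 ∷ 0 ∷ 1 ∷ 1 ∷ 2 ∷ 0 ∷ 1 ∷ 1 ∷ 0 ∷ 0 ∷ l)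
              (applyUpTo-periodic (λ i → profile₁ evenRow (12 + i)) (λ _ → refl) m) ⟩
    3 ∷ 1 ∷ 0 ∷ 0 ∷ 1 ∷ 1 ∷ 2 ∷ 0 ∷ 1 ∷ 1 ∷ 0 ∷ 0 ∷ concat (replicate m (1 ∷ 1 ∷ 0 ∷ 0 ∷ [])) ∎

  odd-row-head : ∀ t → applyUpTo (λ i → G1 n ((5 + 2 * t) * (4 * n) + i)) 9 ≡ 1 ∷ 3 ∷ 2 ∷ 2 ∷ 3 ∷ 3 ∷ 0 ∷ 2 ∷ 3 ∷ []
  odd-row-head t = begin
    applyUpTo (λ i → G1 n ((5 + 2 * t) * (4 * n) + i)) 9
      ≡⟨ row-values (5 + 2 * t) 0 9 (≤-trans (m≤m+n 9 (3 + 4 * m)) (≤-reflexive (sym 4n≡))) ⟩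
    applyUpTo (profile₁ (kind (5 + 2 * t))) 9
      ≡⟨ cong (λ c → applyUpTo (profile₁ (next c)) 9) (kind-even t) ⟩
    1 ∷ 3 ∷ 2 ∷ 2 ∷ 3 ∷ 3 ∷ 0 ∷ 2 ∷ 3 ∷ [] ∎

  window-rows : ∀ t →
    applyUpTo (λ i → G1 n (12 * n + 9 + 8 * n * t + i)) (8 * n)
      ≡ applyUpTo (λ i → G1 n ((3 + 2 * t) * (4 * n) + (9 + i))) (3 + 4 * m)
          ++ applyUpTo (λ i → G1 n ((4 + 2 * t) * (4 * n) + i)) (4 * n)
          ++ applyUpTo (λ i → G1 n ((5 + 2 * t) * (4 * n) + i)) 9
  window-rows t = begin
    applyUpTo (G1 n ∘ pos) (8 * n)
      ≡⟨ cong (applyUpTo (G1 n ∘ pos)) 8n≡ ⟩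
    applyUpTo (G1 n ∘ pos) ((3 + 4 * m) + (4 * n + 9))
      ≡⟨ applyUpTo-++ (G1 n ∘ pos) (3 + 4 * m) (4 * n + 9) ⟩
    applyUpTo (G1 n ∘ pos) (3 + 4 * m) ++ applyUpTo (λ i → G1 n (pos (3 + 4 * m + i))) (4 * n + 9)
      ≡⟨ cong₂ _++_ (cells (3 + 4 * m) odd-tail-cells)
                    (trans (applyUpTo-++ (λ i → G1 n (pos (3 + 4 * m + i))) (4 * n) 9)
                           (cong₂ _++_ (cells (4 * n) even-row-cells) (cells 9 odd-head-cells))) ⟩
    _ ∎
    where
    pos : ℕ → ℕ
    pos i = 12 * n + 9 + 8 * n * t + i
    cells : ∀ {f g : ℕ → ℕ} len → (∀ i → f i ≡ g i) → applyUpTo (G1 n ∘ f) len ≡ applyUpTo (G1 n ∘ g) len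
    cells len f≡g = applyUpTo-cong len (λ {i} _ → cong (G1 n) (f≡g i))
    8n≡ : 8 * n ≡ (3 + 4 * m) + (4 * n + 9)
    8n≡ rewrite n≡3+m = solve (m ∷ [])
    odd-tail-cells : ∀ i → 12 * n + 9 + 8 * n * t + i ≡ (3 + 2 * t) * (4 * n) + (9 + i)
    odd-tail-cells i = solve (n ∷ t ∷ i ∷ [])
    even-row-cells : ∀ i → 12 * n + 9 + 8 * n * t + (3 + 4 * m + i) ≡ (4 + 2 * t) * (4 * n) + i
    even-row-cells i rewrite n≡3+m = solve (m ∷ t ∷ i ∷ [])
    odd-head-cells : ∀ i → 12 * n + 9 + 8 * n * t + (3 + 4 * m + (4 * n + i)) ≡ (5 + 2 * t) * (4 * n) + i
    odd-head-cells i rewrite n≡3+m = solve (m ∷ t ∷ i ∷ [])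

  window : ∀ t → map (λ i → G1 n (12 * n + 9 + 8 * n * t + i)) (upTo (8 * n))
                   ≡ concat (replicate (n ∸ 2) blockP) ++ blockQ ++ blockR
                       ++ concat (replicate (n ∸ 2) blockQ) ++ blockP ++ blockS
  window t = begin
    map (λ i → G1 n (12 * n + 9 + 8 * n * t + i)) (upTo (8 * n))
      ≡⟨ map-upTo _ (8 * n) ⟩
    applyUpTo (λ i → G1 n (12 * n + 9 + 8 * n * t + i)) (8 * n)
      ≡⟨ window-rows t ⟩
    _ ≡⟨ cong₂ _++_ (odd-row-tail t) (cong₂ _++_ (even-row t) (odd-row-head t)) ⟩
    (3 ∷ 2 ∷ 2 ∷ concat (replicate m (3 ∷ 3 ∷ 2 ∷ 2 ∷ [])))
      ++ (3 ∷ 1 ∷ 0 ∷ 0 ∷ 1 ∷ 1 ∷ 2 ∷ 0 ∷ 1 ∷ 1 ∷ 0 ∷ 0 ∷ concat (replicate m (1 ∷ 1 ∷ 0 ∷ 0 ∷ [])))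
      ++ (1 ∷ 3 ∷ 2 ∷ 2 ∷ 3 ∷ 3 ∷ 0 ∷ 2 ∷ 3 ∷ [])
      ≡⟨ window-blocks m ⟩
    concat (replicate (suc m) blockP) ++ blockQ ++ blockR ++ concat (replicate (suc m) blockQ) ++ blockP ++ blockS
      ≡⟨ cong (λ q → concat (replicate q blockP) ++ blockQ ++ blockR ++ concat (replicate q blockQ) ++ blockP ++ blockS)
              (cong (_∸ 2) n≡3+m) ⟨
    concat (replicate (n ∸ 2) blockP) ++ blockQ ++ blockR ++ concat (replicate (n ∸ 2) blockQ) ++ blockP ++ blockS ∎

theorem18 : (n : ℕ) → 3 ≤ n →
    ((t : ℕ) →
      map (λ i → G1 n (12 * n + 9 + 8 * n * t + i)) (upTo (8 * n))
        ≡ concat (replicate (n ∸ 2) blockP) ++ blockQ ++ blockR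
            ++ concat (replicate (n ∸ 2) blockQ) ++ blockP ++ blockS)
    × ((x : ℕ) → 12 * n + 9 ≤ x → G1 n (x + 8 * n) ≡ G1 n x)
theorem18 n@(suc (suc (suc m))) _ = window , window-periodic (G1 n) (12 * n + 9) (8 * n) _ window
  where open Rows n m refl using (window)
theorem18 1 (s≤s ())
theorem18 2 (s≤s (s≤s ()))
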